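{- None of the concept languages $\mathcal{L}(\geq,\sqcup)$, $\mathcal{L}(\geq,\bot)$ and $\mathcal{L}(\forall,\exists,-,\sqcap)$ admits finite characterisations.
   Context: Fix infinite disjoint sets $N_C$, $N_R$ of concept and role names. For finite $\Sigma_C\subseteq N_C,\Sigma_R\subseteq N_R$ and a set $\mathbf O$ of constructors, $\mathcal L(\mathbf O)[\Sigma_C,\Sigma_R]$ is the set of concepts built from concept names in $\Sigma_C$ using only the constructors in $\mathbf O$: $\sqcup$ (union), $\sqcap$ (intersection), $\bot$ (empty concept), $\exists S.C$, $\forall S.C$, $\geq k\,S.C$ ($k\ge1$; at least $k$ pairwise distinct $S$-successors in $C$), where $S$ is a role name $R\in\Sigma_R$, or, only if $-\in\mathbf O$, its inverse $R^-$ (interpreted as the converse relation); standard semantics. $C\equiv D$ means $C^{\mathcal I}=D^{\mathcal I}$ for all interpretations. An example is a finite pointed interpretation $(\mathcal I,d)$ labelled positive or negative; $C$ fits $E=(E^+,E^-)$ if $d\in C^{\mathcal I}$ for positive and $d\notin C^{\mathcal I}$ for negative examples. A finite characterisation of $C$ w.r.t. $\mathcal L$ is a finite $E$ such that $C$ fits $E$ and every $D\in\mathcal L$ fitting $E$ is equivalent to $C$. $\mathcal L(\mathbf O)$ admits finite characterisations if for all finite $\Sigma_C,\Sigma_R$, every $C\in\mathcal L(\mathbf O)[\Sigma_C,\Sigma_R]$ has a finite characterisation w.r.t. $\mathcal L(\mathbf O)[\Sigma_C,\Sigma_R]$. -}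

module Defs where

open import Data.Nat using (ℕ; zero; suc; _≤_)
open import Data.Fin using (Fin)
open import Data.Bool using (Bool; T)
open import Data.List using (List)
open import Data.List.Membership.Propositional using (_∈_)
open import Data.List.Relation.Unary.All using (All)
open import Data.Product using (Σ; _×_)
open import Data.Sum using (_⊎_)
open import Data.Empty renaming (⊥ to Empty)
open import Data.Unit using (⊤)
open import Relation.Nullary using (¬_)
open import Relation.Binary.PropositionalEquality using (_≡_)

-- Signature: Σ_C ≅ Fin m concept names, Σ_R ≅ Fin n role names.

data Role (n : ℕ) : Set where
  rn  : Fin n → Role n
  inv : Fin n → Role n

data Concept (m n : ℕ) : Set where
  name    : Fin m → Concept m n
  bot     : Concept m n
  _⊓_     : Concept m n → Concept m n → Concept m n
  _⊔_     : Concept m n → Concept m n → Concept m n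
  ex      : Role n → Concept m n → Concept m n
  all     : Role n → Concept m n → Concept m n
  atLeast : ℕ → Role n → Concept m n → Concept m n

data Op : Set where
  opUnion opInter opBot opEx opAll opAtLeast opInv : Op

RoleIn : {n : ℕ} → List Op → Role n → Set
RoleIn O (rn R)  = ⊤
RoleIn O (inv R) = opInv ∈ O

data InL {m n : ℕ} (O : List Op) : Concept m n → Set where
  name    : ∀ A → InL O (name A)
  bot     : opBot ∈ O → InL O bot
  inter   : ∀ {C D} → opInter ∈ O → InL O C → InL O D → InL O (C ⊓ D)
  union   : ∀ {C D} → opUnion ∈ O → InL O C → InL O D → InL O (C ⊔ D)
  ex      : ∀ {S C} → opEx ∈ O → RoleIn O S → InL O C → InL O (ex S C)
  all     : ∀ {S C} → opAll ∈ O → RoleIn O S → InL O C → InL O (all S C)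
  atLeast : ∀ {k S C} → opAtLeast ∈ O → 1 ≤ k → RoleIn O S → InL O C
            → InL O (atLeast k S C)

record Interp (m n : ℕ) : Set₁ where
  field
    Δ    : Set
    conc : Fin m → Δ → Set
    role : Fin n → Δ → Δ → Set

module _ {m n : ℕ} (I : Interp m n) where
  open Interp I

  relOf : Role n → Δ → Δ → Set
  relOf (rn R)  d e = role R d e
  relOf (inv R) d e = role R e d

  ⟦_⟧ : Concept m n → Δ → Set
  ⟦ name A ⟧ d = conc A d
  ⟦ bot ⟧ d = Empty
  ⟦ C ⊓ D ⟧ d = ⟦ C ⟧ d × ⟦ D ⟧ d
  ⟦ C ⊔ D ⟧ d = ⟦ C ⟧ d ⊎ ⟦ D ⟧ d
  ⟦ ex S C ⟧ d = Σ Δ (λ e → relOf S d e × ⟦ C ⟧ e)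
  ⟦ all S C ⟧ d = (e : Δ) → relOf S d e → ⟦ C ⟧ e
  ⟦ atLeast k S C ⟧ d =
    Σ (Fin k → Δ) (λ f → ((i j : Fin k) → f i ≡ f j → i ≡ j)
                         × ((i : Fin k) → relOf S d (f i) × ⟦ C ⟧ (f i)))

_≡ᶜ_ : {m n : ℕ} → Concept m n → Concept m n → Set₁
_≡ᶜ_ {m} {n} C D = (I : Interp m n) (d : Interp.Δ I) →
  (⟦ I ⟧ C d → ⟦ I ⟧ D d) × (⟦ I ⟧ D d → ⟦ I ⟧ C d)

record FinInterp (m n : ℕ) : Set where
  field
    size : ℕ
    conc : Fin m → Fin size → Bool
    role : Fin n → Fin size → Fin size → Bool

toInterp : {m n : ℕ} → FinInterp m n → Interp m n
toInterp J = record
  { Δ = Fin (FinInterp.size J)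
  ; conc = λ A d → T (FinInterp.conc J A d)
  ; role = λ R d e → T (FinInterp.role J R d e) }

record Example (m n : ℕ) : Set where
  field
    interp : FinInterp m n
    point  : Fin (FinInterp.size interp)

Holds : {m n : ℕ} → Concept m n → Example m n → Set
Holds C x = ⟦ toInterp (Example.interp x) ⟧ C (Example.point x)

record Examples (m n : ℕ) : Set where
  field
    pos : List (Example m n)
    neg : List (Example m n)

Fits : {m n : ℕ} → Concept m n → Examples m n → Set
Fits C E = All (Holds C) (Examples.pos E) × All (λ e → ¬ Holds C e) (Examples.neg E)

FinChar : {m n : ℕ} → List Op → Concept m n → Examples m n → Set₁
FinChar O C E = Fits C E × ((D : Concept _ _) → InL O D → Fits D E → C ≡ᶜ D)

AdmitsFinChar : List Op → Set₁
AdmitsFinChar O = (m n : ℕ) (C : Concept m n) → InL O C → Σ (Examples m n) (FinChar O C)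

-- Each language L fails to characterise a concept C ∈ L finitely because for every
-- bound N there is a D ∈ L that is not equivalent to C yet agrees with C on all
-- interpretations with at most N elements.  Number restrictions ≥ (N+1) R.A cannot hold
-- in such small interpretations, which settles the two languages with ≥.  For
-- L(∀,∃,⁻,⊓) take C = ∃R.A and D = C ⊓ ∀Rᴷ.(∃R⁻)^(K + K!).C with K = N + 1: in a small
-- interpretation every R-path of length K repeats a node, and pumping that cycle,
-- whose length divides K!, yields an R-path of length K + K! from the C-element we
-- started at.  On the infinite R-chain no such path exists.
module Submission where

open import Defs
open import Data.Nat using (ℕ; zero; suc; _+_; _*_; _≤_; _<_; z≤n; s≤s; _!)
open import Data.Nat.Properties
open import Data.Nat.Divisibility using (_∣_; divides; ∣-trans; m∣m*n; m≤n⇒m!∣n!)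
open import Data.Fin using (Fin; toℕ) renaming (zero to fzero; suc to fsuc)
open import Data.Fin.Properties using (pigeonhole; injective⇒≤; toℕ≤pred[n]; toℕ-injective)
open import Data.List using (List; []; _∷_; _++_; map)
open import Data.List.Extrema.Nat using (max; xs≤max)
open import Data.List.Membership.Propositional using (_∈_)
open import Data.List.Membership.Propositional.Properties using (∈-++⁺ˡ; ∈-++⁺ʳ)
import Data.List.Relation.Unary.All as All
open import Data.List.Relation.Unary.All.Properties using (map⁻)
open import Data.List.Relation.Unary.Any using (here; there)
open import Data.Product using (Σ; _×_; _,_; proj₁; proj₂)
open import Data.Sum using (inj₁; inj₂; [_,_]′)
open import Data.Unit using (⊤; tt)
open import Data.Empty using (⊥-elim)
open import Function using (id; _⇔_; mk⇔; Equivalence)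
open import Relation.Nullary using (¬_)
open import Relation.Binary.PropositionalEquality using (_≡_; refl; sym; trans; subst)

private
  variable
    m n : ℕ

exampleSize : Example m n → ℕ
exampleSize x = FinInterp.size (Example.interp x)

maxExampleSize : List (Example m n) → ℕ
maxExampleSize xs = max 0 (map exampleSize xs)

exampleSize≤max : ∀ {x} {xs : List (Example m n)} → x ∈ xs → exampleSize x ≤ maxExampleSize xs
exampleSize≤max {xs = xs} = All.lookup (map⁻ (xs≤max 0 (map exampleSize xs)))

AgreeUpTo : ℕ → Concept m n → Concept m n → Set
AgreeUpTo N C D = ∀ x → exampleSize x ≤ N → Holds C x ⇔ Holds D x

agreeUpTo⇒fits : ∀ {N} (C D : Concept m n) (E : Examples m n) →
                 (∀ {x} → x ∈ Examples.pos E ++ Examples.neg E → exampleSize x ≤ N) →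
                 AgreeUpTo N C D → Fits C E → Fits D E
agreeUpTo⇒fits C D E small agree (pos , neg) =
    All.tabulate (λ x∈ → Equivalence.to (agree _ (small (∈-++⁺ˡ x∈))) (All.lookup pos x∈))
  , All.tabulate (λ x∈ hD → All.lookup neg x∈
                   (Equivalence.from (agree _ (small (∈-++⁺ʳ (Examples.pos E) x∈))) hD))

¬admitsFinChar : ∀ {O} (C : Concept m n) → InL O C →
                 (∀ N → Σ (Concept m n) λ D → InL O D × AgreeUpTo N C D × ¬ C ≡ᶜ D) →
                 ¬ AdmitsFinChar O
¬admitsFinChar C C∈L rival admits with admits _ _ C C∈L
... | E , C-fits , characterises with rival (maxExampleSize (Examples.pos E ++ Examples.neg E))
... | D , D∈L , agree , C≢D =
  C≢D (characterises D D∈L (agreeUpTo⇒fits C D E exampleSize≤max agree C-fits))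

module _ {A : Set} (R : A → A → Set) where

  infixr 5 _∷_
  data Path : ℕ → A → A → Set where
    []  : ∀ {x} → Path 0 x x
    _∷_ : ∀ {k x y z} → R x y → Path k y z → Path (suc k) x z

  Pumpable : ℕ → A → A → Set
  Pumpable k x y = Σ ℕ λ c → 0 < c × c ≤ k × (∀ q → Path (k + q * c) x y)

module _ {A : Set} {R : A → A → Set} where

  infixr 5 _++ᵖ_
  _++ᵖ_ : ∀ {k l x y z} → Path R k x y → Path R l y z → Path R (k + l) x z
  []      ++ᵖ q = q
  (r ∷ p) ++ᵖ q = r ∷ (p ++ᵖ q)

  repeat : ∀ {c x} (q : ℕ) → Path R c x x → Path R (q * c) x x
  repeat zero    p = []
  repeat (suc q) p = p ++ᵖ repeat q p

  node : ∀ {k x y} → Path R k x y → Fin (suc k) → A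
  node {x = x} _ fzero    = x
  node (r ∷ p) (fsuc i) = node p i

  prefix : ∀ {k x y} (p : Path R k x y) (i : Fin (suc k)) → Path R (toℕ i) x (node p i)
  prefix _       fzero    = []
  prefix (r ∷ p) (fsuc i) = r ∷ prefix p i

  cycle⇒pumpable : ∀ {c k x y} → 0 < c → c ≤ k → Path R c x x → Path R k x y → Pumpable R k x y
  cycle⇒pumpable {c} {k} {x} {y} 0<c c≤k cycle p = c , 0<c , c≤k , λ q →
    subst (λ l → Path R l x y) (+-comm (q * c) k) (repeat q cycle ++ᵖ p)

  repeatedNode⇒pumpable : ∀ {k x y} (p : Path R k x y) {i j : Fin (suc k)} →
                          toℕ i < toℕ j → node p i ≡ node p j → Pumpable R k x y
  repeatedNode⇒pumpable rp@(r ∷ p) {fzero} {fsuc j} _ x≡node =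
    cycle⇒pumpable (s≤s z≤n) (s≤s (toℕ≤pred[n] j))
                   (r ∷ subst (Path R _ _) (sym x≡node) (prefix p j)) rp
  repeatedNode⇒pumpable (r ∷ p) {fsuc i} {fsuc j} (s≤s i<j) eq
    with c , 0<c , c≤k , pumped ← repeatedNode⇒pumpable p i<j eq
    = c , 0<c , m≤n⇒m≤1+n c≤k , λ q → r ∷ pumped q

longPath⇒pumpable : ∀ {s k} {R : Fin s → Fin s → Set} {x y} →
                    s ≤ k → Path R k x y → Pumpable R k x y
longPath⇒pumpable s≤k p with i , j , i<j , eq ← pigeonhole (s≤s s≤k) (node p) =
  repeatedNode⇒pumpable p i<j eq

m∣n! : ∀ {m n} → 0 < m → m ≤ n → m ∣ n !
m∣n! {suc m} _ m≤n = ∣-trans (m∣m*n (m !)) (m≤n⇒m!∣n! m≤n)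

longPath-+! : ∀ {s k} {R : Fin s → Fin s → Set} {x y} →
              s ≤ k → Path R k x y → Path R (k + k !) x y
longPath-+! {k = k} {R} {x} {y} s≤k p
  with c , 0<c , c≤k , pumped ← longPath⇒pumpable s≤k p
  with divides q k!≡q*c ← m∣n! {n = k} 0<c c≤k =
  subst (λ l → Path R (k + l) x y) (sym k!≡q*c) (pumped q)

allⁿ : ℕ → Fin n → Concept m n → Concept m n
allⁿ zero    R C = C
allⁿ (suc k) R C = all (rn R) (allⁿ k R C)

-- Nested from the inside, so that the outermost ∃R⁻ is the last step of an R-path.
exInvⁿ : ℕ → Fin n → Concept m n → Concept m n
exInvⁿ zero    R C = C
exInvⁿ (suc k) R C = exInvⁿ k R (ex (inv R) C)

allⁿ∈L : ∀ {O} k (R : Fin n) {C : Concept m n} → opAll ∈ O → InL O C → InL O (allⁿ k R C)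
allⁿ∈L zero    R _    C∈L = C∈L
allⁿ∈L (suc k) R all∈ C∈L = all all∈ tt (allⁿ∈L k R all∈ C∈L)

exInvⁿ∈L : ∀ {O} k (R : Fin n) {C : Concept m n} → opEx ∈ O → opInv ∈ O → InL O C →
           InL O (exInvⁿ k R C)
exInvⁿ∈L zero    R _   _    C∈L = C∈L
exInvⁿ∈L (suc k) R ex∈ inv∈ C∈L = exInvⁿ∈L k R ex∈ inv∈ (ex ex∈ inv∈ C∈L)

module _ (I : Interp m n) (R : Fin n) where
  open Interp I

  allⁿ-intro : ∀ k {C x} → (∀ {y} → Path (role R) k x y → ⟦ I ⟧ C y) → ⟦ I ⟧ (allⁿ k R C) x
  allⁿ-intro zero    h     = h []
  allⁿ-intro (suc k) h _ r = allⁿ-intro k (λ p → h (r ∷ p))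

  allⁿ-elim : ∀ {k C x y} → ⟦ I ⟧ (allⁿ k R C) x → Path (role R) k x y → ⟦ I ⟧ C y
  allⁿ-elim h []      = h
  allⁿ-elim h (r ∷ p) = allⁿ-elim (h _ r) p

  exInvⁿ-intro : ∀ {k C x y} → Path (role R) k x y → ⟦ I ⟧ C x → ⟦ I ⟧ (exInvⁿ k R C) y
  exInvⁿ-intro []      c = c
  exInvⁿ-intro (r ∷ p) c = exInvⁿ-intro p (_ , r , c)

  exInvⁿ-elim : ∀ k {C y} → ⟦ I ⟧ (exInvⁿ k R C) y → Σ Δ λ x → Path (role R) k x y × ⟦ I ⟧ C x
  exInvⁿ-elim zero    c = _ , [] , c
  exInvⁿ-elim (suc k) h with _ , p , (x , r , c) ← exInvⁿ-elim k h = x , r ∷ p , c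

¬atLeast-small : ∀ {N} {S : Role n} {C : Concept m n} (x : Example m n) →
                 exampleSize x ≤ N → ¬ Holds (atLeast (suc N) S C) x
¬atLeast-small x small (f , f-injective , _) = ≤⇒≯ small (injective⇒≤ (λ {i j} → f-injective i j))

A : Concept 1 1
A = name fzero

R : Fin 1
R = fzero

-- The point 0 ∉ A has arbitrarily many A-successors.
infiniteStar : Interp 1 1
infiniteStar = record { Δ = ℕ ; conc = λ _ x → 0 < x ; role = λ _ _ _ → ⊤ }

atLeast-infiniteStar : ∀ k → ⟦ infiniteStar ⟧ (atLeast k (rn R) A) 0
atLeast-infiniteStar k =
  (λ i → suc (toℕ i)) , (λ i j eq → toℕ-injective (suc-injective eq)) , λ i → tt , s≤s z≤n

¬admitsFinChar-atLeast-union : ¬ AdmitsFinChar (opAtLeast ∷ opUnion ∷ [])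
¬admitsFinChar-atLeast-union = ¬admitsFinChar A (name fzero) λ N →
    A ⊔ atLeast (suc N) (rn R) A
  , union (there (here refl)) (name fzero) (atLeast (here refl) (s≤s z≤n) tt (name fzero))
  , (λ x small → mk⇔ inj₁ [ id , (λ h → ⊥-elim (¬atLeast-small {S = rn R} {A} x small h)) ]′)
  , λ A≡D → 0∉A (proj₂ (A≡D infiniteStar 0) (inj₂ (atLeast-infiniteStar (suc N))))
  where
  0∉A : ¬ ⟦ infiniteStar ⟧ A 0
  0∉A ()

¬admitsFinChar-atLeast-bot : ¬ AdmitsFinChar (opAtLeast ∷ opBot ∷ [])
¬admitsFinChar-atLeast-bot = ¬admitsFinChar bot (bot (there (here refl))) λ N →
    atLeast (suc N) (rn R) A
  , atLeast (here refl) (s≤s z≤n) tt (name fzero)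
  , (λ x small → mk⇔ ⊥-elim (λ h → ⊥-elim (¬atLeast-small {S = rn R} {A} x small h)))
  , λ bot≡D → proj₂ (bot≡D infiniteStar 0) (atLeast-infiniteStar (suc N))

someA : Concept 1 1
someA = ex (rn R) A

impostor : ℕ → Concept 1 1
impostor K = someA ⊓ allⁿ K R (exInvⁿ (K + K !) R someA)

someA⇒impostor : ∀ {N} (x : Example 1 1) → exampleSize x ≤ N →
                 Holds someA x → Holds (impostor (suc N)) x
someA⇒impostor {N} x small hC = hC , allⁿ-intro I R (suc N) λ p →
  exInvⁿ-intro I R (longPath-+! (m≤n⇒m≤1+n small) p) hC
  where
  I : Interp 1 1
  I = toInterp (Example.interp x)

chain : Interp 1 1
chain = record { Δ = ℕ ; conc = λ _ _ → ⊤ ; role = λ _ x y → y ≡ suc x }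

chain-ascend : ∀ k x → Path (Interp.role chain R) k x (k + x)
chain-ascend zero    x = []
chain-ascend (suc k) x = refl ∷ subst (Path _ k (suc x)) (+-suc k x) (chain-ascend k (suc x))

chain-length : ∀ {k x y} → Path (Interp.role chain R) k x y → k + x ≡ y
chain-length              []         = refl
chain-length {suc k} {x} (refl ∷ p) = trans (sym (+-suc k x)) (chain-length p)

¬impostor-chain : ∀ K → ¬ ⟦ chain ⟧ (impostor K) 0
¬impostor-chain K (_ , h)
  with x , p , _ ← exInvⁿ-elim chain R (K + K !) (allⁿ-elim chain R h (chain-ascend K 0)) =
  <⇒≱ (m<m+n K (1≤n! K))
      (≤-trans (m≤m+n (K + K !) x) (≤-reflexive (trans (chain-length p) (+-identityʳ K))))

¬admitsFinChar-all-ex-inv-inter : ¬ AdmitsFinChar (opAll ∷ opEx ∷ opInv ∷ opInter ∷ [])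
¬admitsFinChar-all-ex-inv-inter = ¬admitsFinChar someA someA∈L λ N → let K = suc N in
    impostor K
  , inter inter∈ someA∈L (allⁿ∈L K R all∈ (exInvⁿ∈L (K + K !) R ex∈ inv∈ someA∈L))
  , (λ x small → mk⇔ (someA⇒impostor x small) proj₁)
  , λ someA≡impostor → ¬impostor-chain K (proj₁ (someA≡impostor chain 0) (1 , refl , tt))
  where
  O : List Op
  O = opAll ∷ opEx ∷ opInv ∷ opInter ∷ []
  all∈ : opAll ∈ O
  all∈ = here refl
  ex∈ : opEx ∈ O
  ex∈ = there (here refl)
  inv∈ : opInv ∈ O
  inv∈ = there (there (here refl))
  inter∈ : opInter ∈ O
  inter∈ = there (there (there (here refl)))
  someA∈L : InL O someA
  someA∈L = ex ex∈ tt (name fzero)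

theorem11 : ¬ AdmitsFinChar (opAtLeast ∷ opUnion ∷ [])
    × ¬ AdmitsFinChar (opAtLeast ∷ opBot ∷ [])
    × ¬ AdmitsFinChar (opAll ∷ opEx ∷ opInv ∷ opInter ∷ [])
theorem11 =
  ¬admitsFinChar-atLeast-union , ¬admitsFinChar-atLeast-bot , ¬admitsFinChar-all-ex-inv-inter
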